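{- Let $\mathcal F\subseteq\mathcal P([n])$ be a diamond-saturated family with $\emptyset\notin\mathcal F$ and $[n]\notin\mathcal F$. Let $\mathcal B$ be the set of maximal elements of $\mathcal F$; let $\mathcal A_0$ be the set of $X\in\mathcal P([n])$ for which there exist $P,Q,R\in\mathcal F$ such that $R,P,Q,X$ form an induced diamond with $X$ as its maximal element; let $\mathcal A_1$ be the set of minimal elements of $\mathcal A_0$; and let $\mathcal A=\{X\in\mathcal A_1: X \text{ contains no set of }\mathcal B\text{ as a subset}\}$. Then $\min\{|B|:B\in\mathcal B\}\geq n-|\mathcal F|$ and $\max\{|A|:A\in\mathcal A\}\leq|\mathcal F|$.
   Context: $\mathcal P([n])$ is ordered by inclusion. Four distinct sets $R,P,Q,X$ form an induced diamond with $X$ maximal if $R\subsetneq P\subsetneq X$, $R\subsetneq Q\subsetneq X$ and $P,Q$ are incomparable. $\mathcal F$ is diamond-saturated if it contains no induced diamond (four sets of $\mathcal F$ in this configuration) but for every $S\notin\mathcal F$, $\mathcal F\cup\{S\}$ contains one. -}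

module Defs where

open import Data.Nat using (ℕ)
open import Data.Product using (Σ; ∃; _×_)
open import Data.List using (List; _∷_)
open import Data.Fin.Subset using (Subset; _⊆_; _⊂_; _⊈_)
import Data.List.Membership.Propositional as LM
open import Relation.Binary.PropositionalEquality using (_≡_)
open import Relation.Nullary using (¬_)

-- A family of subsets of [n] = Fin n, given as a duplicate-free list
-- (duplicate-freeness is imposed in the statement via Unique).
Family : ℕ → Set
Family n = List (Subset n)

module _ {n : ℕ} where

  infix 4 _∈F_ _∉F_
  _∈F_ : Subset n → Family n → Set
  S ∈F 𝓕 = S LM.∈ 𝓕

  _∉F_ : Subset n → Family n → Set
  S ∉F 𝓕 = ¬ (S ∈F 𝓕)

  IndDiamond : Subset n → Subset n → Subset n → Subset n → Set
  IndDiamond R P Q X =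
    R ⊂ P × P ⊂ X × R ⊂ Q × Q ⊂ X × P ⊈ Q × Q ⊈ P

  ContainsDiamond : Family n → Set
  ContainsDiamond 𝓕 =
    ∃ λ R → ∃ λ P → ∃ λ Q → ∃ λ X →
      R ∈F 𝓕 × P ∈F 𝓕 × Q ∈F 𝓕 × X ∈F 𝓕 × IndDiamond R P Q X

  DiamondSaturated : Family n → Set
  DiamondSaturated 𝓕 =
    ¬ ContainsDiamond 𝓕 × (∀ S → S ∉F 𝓕 → ContainsDiamond (S ∷ 𝓕))

  MaximalIn : Family n → Subset n → Set
  MaximalIn 𝓕 B = B ∈F 𝓕 × (∀ C → C ∈F 𝓕 → ¬ (B ⊂ C))

  InA₀ : Family n → Subset n → Set
  InA₀ 𝓕 X = ∃ λ P → ∃ λ Q → ∃ λ R →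
    P ∈F 𝓕 × Q ∈F 𝓕 × R ∈F 𝓕 × IndDiamond R P Q X

  InA₁ : Family n → Subset n → Set
  InA₁ 𝓕 X = InA₀ 𝓕 X × (∀ Y → InA₀ 𝓕 Y → ¬ (Y ⊂ X))

  InA : Family n → Subset n → Set
  InA 𝓕 X = InA₁ 𝓕 X × (∀ B → MaximalIn 𝓕 B → B ⊈ X)

-- Both bounds come from injecting a set of coordinates into 𝓕. For a maximal B and
-- x ∉ B, the set B ∪ {x} is not in 𝓕 and lies below no member of 𝓕, so by saturation
-- it is the top of a diamond over 𝓕; one side of that diamond must contain x (otherwise
-- B itself would be its top), and that side meets ∁B exactly in {x}. For a minimal
-- diamond top A and x ∈ A, the set A - x is not a diamond top, so by saturation some
-- E ∈ 𝓕 contains it; E cannot contain all of A (A would then lift to a diamond topped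
-- by E), so A ∖ E = {x}.
module Submission where

open import Defs
open import Data.Nat using (ℕ; zero; suc; _≤_; _+_; _∸_; z≤n; s≤s)
open import Data.Nat.Properties using (≤-trans; m≤n+m∸n; +-monoʳ-≤)
open import Data.Product using (_×_; _,_; ∃)
open import Data.Sum using (_⊎_; inj₁; inj₂)
open import Data.List using (List; _∷_; length)
open import Data.List.Relation.Unary.Any using (here; there; index; any?)
open import Data.List.Relation.Unary.Unique.Propositional using (Unique)
open import Data.List.Membership.Propositional using () renaming (_∈_ to _∈ₗ_)
open import Data.List.Membership.Setoid.Properties using (index-injective)
open import Data.Fin using (Fin; zero; suc; punchOut; _≟_)
open import Data.Fin.Properties using (suc-injective; punchOut-injective; 0≢1+n)
open import Data.Fin.Subset
  using (Subset; ⊥; ⊤; ∣_∣; _∈_; _∉_; _⊆_; _⊂_; _⊈_; _∪_; ⁅_⁆; _-_; ∁; inside; outside)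
open import Data.Fin.Subset.Properties
open import Data.Vec using ([]; _∷_; here; there)
open import Data.Vec.Properties using (≡-dec)
import Data.Bool as Bool
open import Function using (id; _∘_)
open import Relation.Binary.PropositionalEquality using (_≡_; _≢_; refl; subst; setoid)
open import Relation.Nullary using (¬_; yes; no; contradiction)

injective⇒∣p∣≤ : ∀ {m n} (p : Subset n) (f : ∀ {x} → x ∈ p → Fin m) →
  (∀ {x y} (x∈p : x ∈ p) (y∈p : y ∈ p) → f x∈p ≡ f y∈p → x ≡ y) → ∣ p ∣ ≤ m
injective⇒∣p∣≤ [] f inj = z≤n
injective⇒∣p∣≤ (outside ∷ p) f inj =
  injective⇒∣p∣≤ p (f ∘ there) (λ x∈p y∈p → suc-injective ∘ inj (there x∈p) (there y∈p))
injective⇒∣p∣≤ {zero} (inside ∷ p) f inj with f here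
... | ()
injective⇒∣p∣≤ {suc m} (inside ∷ p) f inj = s≤s (injective⇒∣p∣≤ p g g-injective)
  where
  f₀≢ : ∀ {x} (x∈p : x ∈ p) → f here ≢ f (there x∈p)
  f₀≢ x∈p = 0≢1+n ∘ inj here (there x∈p)

  g : ∀ {x} → x ∈ p → Fin m
  g x∈p = punchOut (f₀≢ x∈p)

  g-injective : ∀ {x y} (x∈p : x ∈ p) (y∈p : y ∈ p) → g x∈p ≡ g y∈p → x ≡ y
  g-injective x∈p y∈p = suc-injective ∘ inj (there x∈p) (there y∈p) ∘ punchOut-injective (f₀≢ x∈p) (f₀≢ y∈p)

module _ {n : ℕ} where

  _isolates_within_ : Subset n → Fin n → Subset n → Set
  W isolates x within U = x ∈ W × (∀ {z} → z ∈ U → z ∈ W → z ≡ x)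

  ∣p∣≤length-isolating : ∀ {A : Set} (sel : A → Subset n) (U : Subset n) (Es : List A) →
    (∀ {x} → x ∈ U → ∃ λ E → E ∈ₗ Es × sel E isolates x within U) → ∣ U ∣ ≤ length Es
  ∣p∣≤length-isolating {A} sel U Es isolating = injective⇒∣p∣≤ U position position-injective
    where
    position : ∀ {x} → x ∈ U → Fin (length Es)
    position x∈U with isolating x∈U
    ... | _ , E∈Es , _ = index E∈Es

    position-injective : ∀ {x y} (x∈U : x ∈ U) (y∈U : y ∈ U) → position x∈U ≡ position y∈U → x ≡ y
    position-injective x∈U y∈U same with isolating x∈U | isolating y∈U
    ... | E , E∈Es , x∈E , _ | E′ , E′∈Es , _ , only-y with index-injective (setoid A) E∈Es E′∈Es same
    ... | refl = only-y x∈U x∈E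

  ⊆∧⊈⇒⊂ : {p q : Subset n} → p ⊆ q → q ⊈ p → p ⊂ q
  ⊆∧⊈⇒⊂ {p} {q} p⊆q q⊈p with p ⊂? q
  ... | yes p⊂q = p⊂q
  ... | no p⊄q = contradiction (λ {_} → q⊆p) q⊈p
    where
    q⊆p : q ⊆ p
    q⊆p {x} x∈q with x ∈? p
    ... | yes x∈p = x∈p
    ... | no x∉p = contradiction ((λ {_} → p⊆q) , x , x∈q , x∉p) p⊄q

  x∈p∪⁅y⁆⇒x∈p⊎x≡y : ∀ {p : Subset n} {x y} → x ∈ p ∪ ⁅ y ⁆ → x ∈ p ⊎ x ≡ y
  x∈p∪⁅y⁆⇒x∈p⊎x≡y {p} {x} {y} x∈p∪y with x∈p∪q⁻ p ⁅ y ⁆ x∈p∪y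
  ... | inj₁ x∈p = inj₁ x∈p
  ... | inj₂ x∈y = inj₂ (x∈⁅y⁆⇒x≡y y x∈y)

  x∈p⇒x≡y⊎x∈p-y : ∀ {p : Subset n} {x y} → x ∈ p → x ≡ y ⊎ x ∈ p - y
  x∈p⇒x≡y⊎x∈p-y {x = x} {y} x∈p with x ≟ y
  ... | yes x≡y = inj₁ x≡y
  ... | no x≢y = inj₂ (x∈p∧x≢y⇒x∈p-y x∈p x≢y)

  x∉p⇒p⊂p∪⁅x⁆ : ∀ {p : Subset n} {x} → x ∉ p → p ⊂ p ∪ ⁅ x ⁆
  x∉p⇒p⊂p∪⁅x⁆ {p} {x} x∉p = p⊆p∪q ⁅ x ⁆ , x , x∈p∪q⁺ (inj₂ (x∈⁅x⁆ x)) , x∉p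

  p⊆q∪⁅x⁆∧x∉p⇒p⊆q : ∀ {p q : Subset n} {x} → p ⊆ q ∪ ⁅ x ⁆ → x ∉ p → p ⊆ q
  p⊆q∪⁅x⁆∧x∉p⇒p⊆q {p} p⊆q∪x x∉p z∈p with x∈p∪⁅y⁆⇒x∈p⊎x≡y (p⊆q∪x z∈p)
  ... | inj₁ z∈q = z∈q
  ... | inj₂ refl = contradiction z∈p x∉p

  p⊆q∪⁅x⁆∧x∈p⇒p-isolates : ∀ {p q : Subset n} {x} → p ⊆ q ∪ ⁅ x ⁆ → x ∈ p → p isolates x within ∁ q
  p⊆q∪⁅x⁆∧x∈p⇒p-isolates {p} {q} {x} p⊆q∪x x∈p = x∈p , only-x
    where
    only-x : ∀ {z} → z ∈ ∁ q → z ∈ p → z ≡ x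
    only-x z∈∁q z∈p with x∈p∪⁅y⁆⇒x∈p⊎x≡y (p⊆q∪x z∈p)
    ... | inj₁ z∈q = contradiction z∈q (x∈∁p⇒x∉p z∈∁q)
    ... | inj₂ z≡x = z≡x

  p-x⊆q∧x∈q⇒p⊆q : ∀ {p q : Subset n} {x} → p - x ⊆ q → x ∈ q → p ⊆ q
  p-x⊆q∧x∈q⇒p⊆q {x = x} p-x⊆q x∈q z∈p with x∈p⇒x≡y⊎x∈p-y {y = x} z∈p
  ... | inj₁ refl = x∈q
  ... | inj₂ z∈p-x = p-x⊆q z∈p-x

  p-x⊆q∧x∉q⇒∁q-isolates : ∀ {p q : Subset n} {x} → p - x ⊆ q → x ∉ q → ∁ q isolates x within p
  p-x⊆q∧x∉q⇒∁q-isolates {p} {q} {x} p-x⊆q x∉q = x∉p⇒x∈∁p x∉q , only-x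
    where
    only-x : ∀ {z} → z ∈ p → z ∈ ∁ q → z ≡ x
    only-x z∈p z∈∁q with x∈p⇒x≡y⊎x∈p-y {y = x} z∈p
    ... | inj₁ z≡x = z≡x
    ... | inj₂ z∈p-x = contradiction (p-x⊆q z∈p-x) (x∈∁p⇒x∉p z∈∁q)

  IndDiamond-retop : ∀ {R P Q X Y : Subset n} → IndDiamond R P Q X → P ⊆ Y → Q ⊆ Y → IndDiamond R P Q Y
  IndDiamond-retop (R⊂P , _ , R⊂Q , _ , P⊈Q , Q⊈P) P⊆Y Q⊆Y =
    R⊂P , ⊆∧⊈⇒⊂ P⊆Y (λ Y⊆P → Q⊈P (⊆-trans Q⊆Y Y⊆P)) ,
    R⊂Q , ⊆∧⊈⇒⊂ Q⊆Y (λ Y⊆Q → P⊈Q (⊆-trans P⊆Y Y⊆Q)) ,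
    P⊈Q , Q⊈P

module _ {n : ℕ} {𝓕 : Family n} where

  InA₀∧⊆⇒∉ : ∀ {X E} → ¬ ContainsDiamond 𝓕 → InA₀ 𝓕 X → X ⊆ E → E ∉F 𝓕
  InA₀∧⊆⇒∉ noDiamond (P , Q , R , P∈ , Q∈ , R∈ , D@(_ , P⊂X , _ , Q⊂X , _)) X⊆E E∈ =
    noDiamond (R , P , Q , _ , R∈ , P∈ , Q∈ , E∈ ,
      IndDiamond-retop D (⊆-trans (p⊂q⇒p⊆q P⊂X) X⊆E) (⊆-trans (p⊂q⇒p⊆q Q⊂X) X⊆E))

  ∈-∷∧⊂⇒∈ : ∀ {S Y} → Y ∈F S ∷ 𝓕 → Y ⊂ S → Y ∈F 𝓕
  ∈-∷∧⊂⇒∈ (here refl) Y⊂Y = contradiction Y⊂Y (⊂-irref refl)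
  ∈-∷∧⊂⇒∈ (there Y∈) _ = Y∈

  ContainsDiamond-∷⁻ : ∀ {S} → ¬ ContainsDiamond 𝓕 → ContainsDiamond (S ∷ 𝓕) →
    InA₀ 𝓕 S ⊎ ∃ λ Z → Z ∈F 𝓕 × S ⊂ Z
  ContainsDiamond-∷⁻ _ (R , P , Q , _ , R∈ , P∈ , Q∈ , here refl , D@(R⊂P , P⊂S , _ , Q⊂S , _)) =
    inj₁ (P , Q , R , ∈-∷∧⊂⇒∈ P∈ P⊂S , ∈-∷∧⊂⇒∈ Q∈ Q⊂S , ∈-∷∧⊂⇒∈ R∈ (⊂-trans R⊂P P⊂S) , D)
  ContainsDiamond-∷⁻ _ (_ , _ , _ , X , here refl , _ , _ , there X∈ , (R⊂P , P⊂X , _)) =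
    inj₂ (X , X∈ , ⊂-trans R⊂P P⊂X)
  ContainsDiamond-∷⁻ _ (_ , _ , _ , X , there _ , here refl , _ , there X∈ , (_ , P⊂X , _)) =
    inj₂ (X , X∈ , P⊂X)
  ContainsDiamond-∷⁻ _ (_ , _ , _ , X , there _ , there _ , here refl , there X∈ , (_ , _ , _ , Q⊂X , _)) =
    inj₂ (X , X∈ , Q⊂X)
  ContainsDiamond-∷⁻ noDiamond (R , P , Q , X , there R∈ , there P∈ , there Q∈ , there X∈ , D) =
    contradiction (R , P , Q , X , R∈ , P∈ , Q∈ , X∈ , D) noDiamond

  saturated-trichotomy : DiamondSaturated 𝓕 → ∀ S → S ∈F 𝓕 ⊎ InA₀ 𝓕 S ⊎ ∃ λ Z → Z ∈F 𝓕 × S ⊂ Z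
  saturated-trichotomy (noDiamond , saturated) S with any? (≡-dec Bool._≟_ S) 𝓕
  ... | yes S∈ = inj₁ S∈
  ... | no S∉ = inj₂ (ContainsDiamond-∷⁻ noDiamond (saturated S S∉))

  MaximalIn∧∉⇒InA₀-∪⁅x⁆ : DiamondSaturated 𝓕 → ∀ {B x} → MaximalIn 𝓕 B → x ∉ B → InA₀ 𝓕 (B ∪ ⁅ x ⁆)
  MaximalIn∧∉⇒InA₀-∪⁅x⁆ saturated {B} {x} (_ , B-maximal) x∉B
    with saturated-trichotomy saturated (B ∪ ⁅ x ⁆) | x∉p⇒p⊂p∪⁅x⁆ x∉B
  ... | inj₁ S∈ | B⊂S = contradiction B⊂S (B-maximal _ S∈)
  ... | inj₂ (inj₁ S-top) | _ = S-top
  ... | inj₂ (inj₂ (Z , Z∈ , S⊂Z)) | B⊂S = contradiction (⊂-trans B⊂S S⊂Z) (B-maximal Z Z∈)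

  MaximalIn⇒∣∁p∣≤length : DiamondSaturated 𝓕 → ∀ {B} → MaximalIn 𝓕 B → ∣ ∁ B ∣ ≤ length 𝓕
  MaximalIn⇒∣∁p∣≤length saturated@(noDiamond , _) {B} B-maximal@(B∈ , _) =
    ∣p∣≤length-isolating id (∁ B) 𝓕 isolating
    where
    isolating : ∀ {x} → x ∈ ∁ B → ∃ λ E → E ∈F 𝓕 × E isolates x within ∁ B
    isolating {x} x∈∁B with MaximalIn∧∉⇒InA₀-∪⁅x⁆ saturated B-maximal (x∈∁p⇒x∉p x∈∁B)
    ... | P , Q , R , P∈ , Q∈ , R∈ , D@(_ , P⊂S , _ , Q⊂S , _) with x ∈? P | x ∈? Q
    ...   | yes x∈P | _ = P , P∈ , p⊆q∪⁅x⁆∧x∈p⇒p-isolates (p⊂q⇒p⊆q P⊂S) x∈P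
    ...   | no _ | yes x∈Q = Q , Q∈ , p⊆q∪⁅x⁆∧x∈p⇒p-isolates (p⊂q⇒p⊆q Q⊂S) x∈Q
    ...   | no x∉P | no x∉Q = contradiction (R , P , Q , B , R∈ , P∈ , Q∈ , B∈ , D′) noDiamond
      where
      D′ : IndDiamond R P Q B
      D′ = IndDiamond-retop D (p⊆q∪⁅x⁆∧x∉p⇒p⊆q (p⊂q⇒p⊆q P⊂S) x∉P)
                              (p⊆q∪⁅x⁆∧x∉p⇒p⊆q (p⊂q⇒p⊆q Q⊂S) x∉Q)

  InA₁⇒∣p∣≤length : DiamondSaturated 𝓕 → ∀ {A} → InA₁ 𝓕 A → ∣ A ∣ ≤ length 𝓕
  InA₁⇒∣p∣≤length saturated@(noDiamond , _) {A} (A-top , A-minimal) =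
    ∣p∣≤length-isolating ∁ A 𝓕 isolating
    where
    above : ∀ {x} → x ∈ A → ∃ λ E → E ∈F 𝓕 × A - x ⊆ E
    above {x} x∈A with saturated-trichotomy saturated (A - x)
    ... | inj₁ A-x∈ = A - x , A-x∈ , ⊆-refl
    ... | inj₂ (inj₁ A-x-top) = contradiction (x∈p⇒p-x⊂p x∈A) (A-minimal _ A-x-top)
    ... | inj₂ (inj₂ (Z , Z∈ , A-x⊂Z)) = Z , Z∈ , p⊂q⇒p⊆q A-x⊂Z

    isolating : ∀ {x} → x ∈ A → ∃ λ E → E ∈F 𝓕 × ∁ E isolates x within A
    isolating {x} x∈A with above x∈A
    ... | E , E∈ , A-x⊆E = E , E∈ , p-x⊆q∧x∉q⇒∁q-isolates A-x⊆E x∉E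
      where
      x∉E : x ∉ E
      x∉E x∈E = InA₀∧⊆⇒∉ noDiamond A-top (p-x⊆q∧x∈q⇒p⊆q A-x⊆E x∈E) E∈

lemma3 : (n : ℕ) (𝓕 : Family n) → Unique 𝓕 → DiamondSaturated 𝓕 →
    ⊥ ∉F 𝓕 → ⊤ ∉F 𝓕 →
    ((B : Subset n) → MaximalIn 𝓕 B → n ≤ ∣ B ∣ + length 𝓕)
    × ((A : Subset n) → InA 𝓕 A → ∣ A ∣ ≤ length 𝓕)
lemma3 n 𝓕 _ saturated _ _ = maximal-bound , minimal-top-bound
  where
  maximal-bound : (B : Subset n) → MaximalIn 𝓕 B → n ≤ ∣ B ∣ + length 𝓕
  maximal-bound B B-maximal = ≤-trans (m≤n+m∸n n ∣ B ∣) (+-monoʳ-≤ ∣ B ∣ n∸∣B∣≤length)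
    where
    n∸∣B∣≤length : n ∸ ∣ B ∣ ≤ length 𝓕
    n∸∣B∣≤length = subst (_≤ length 𝓕) (∣∁p∣≡n∸∣p∣ B) (MaximalIn⇒∣∁p∣≤length saturated B-maximal)

  minimal-top-bound : (A : Subset n) → InA 𝓕 A → ∣ A ∣ ≤ length 𝓕
  minimal-top-bound A (A-minimal-top , _) = InA₁⇒∣p∣≤length saturated A-minimal-top
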